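{- Let $p$ be a prime, $n\in\mathbb{N}$, $i\in[0,n]$ and $\ell=\ell_p(i)=\lceil\log_p(i+1)\rceil$. (a) There exists $h_i\in\mathbb{F}_p[X_1,\dots,X_n]$ with $\deg h_i\le p^\ell-1$ such that for all $x\in\{0,1\}^n$: $h_i(x)=0$ if and only if $|x|\not\equiv i\pmod{p^\ell}$. (b) For any $j\in i\oplus p^\ell$ with $j>i$, there exists $r_{i,j}\in\mathbb{F}_p[X_1,\dots,X_n]$ with $\deg r_{i,j}\le j-i-p^\ell$ such that for $x\in\{0,1\}^n$: $r_{i,j}(x)=0$ whenever $|x|\in[i+1,j-1]$ and $|x|\equiv i\pmod{p^\ell}$, and $r_{i,j}(x)\neq0$ whenever $|x|=j$.
   Context: For integers $a\le b$, $[a,b]$ denotes the set of integers between $a$ and $b$. For $x\in\{0,1\}^n\subseteq\mathbb{F}_p^n$, $|x|$ is the Hamming weight. For $i\in[0,n]$ and $\ell\in\mathbb{N}$, $i\oplus p^\ell=\{t\in[0,n]:t\equiv i\pmod{p^\ell}\}$. -}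

module Defs where

open import Data.Nat using (ℕ; zero; suc; _+_; _*_; _^_; _≤_; ∣_-_∣)
open import Data.Nat.Divisibility using (_∣_)
open import Data.Fin using (Fin; toℕ)
open import Data.Bool using (Bool; true; false)
open import Data.Vec using (Vec; []; _∷_)
open import Data.List using (List)
open import Data.List.Relation.Unary.All using (All)
open import Data.Product using (_×_)
open import Relation.Binary.PropositionalEquality using (_≡_)
open import Relation.Nullary using (¬_)

weight : ∀ {n} → Vec Bool n → ℕ
weight [] = 0
weight (true ∷ xs) = suc (weight xs)
weight (false ∷ xs) = weight xs

infix 4 _≡_[mod_]
_≡_[mod_] : ℕ → ℕ → ℕ → Set
a ≡ b [mod m ] = m ∣ ∣ a - b ∣

IsCeilLog : ℕ → ℕ → ℕ → Set
IsCeilLog p m ℓ = (m ≤ p ^ ℓ) × (∀ k → m ≤ p ^ k → ℓ ≤ k)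

-- Polynomials in F_p[X_1..X_n]: finite lists of terms (coefficient in F_p = Fin p,
-- exponent vector).  A polynomial is the sum of its terms.
Monomial : ℕ → Set
Monomial n = Vec ℕ n

record Term (p n : ℕ) : Set where
  constructor term
  field
    coeff : Fin p
    expo  : Monomial n

Poly : ℕ → ℕ → Set
Poly p n = List (Term p n)

totalDeg : ∀ {n} → Monomial n → ℕ
totalDeg [] = 0
totalDeg (e ∷ es) = e + totalDeg es

DegLe : ∀ {p n} → Poly p n → ℕ → Set
DegLe h d = All (λ t → ¬ (toℕ (Term.coeff t) ≡ 0) → totalDeg (Term.expo t) ≤ d) h

b2n : Bool → ℕ
b2n true = 1
b2n false = 0

evalMon : ∀ {n} → Monomial n → Vec Bool n → ℕ
evalMon [] [] = 1
evalMon (e ∷ es) (x ∷ xs) = (b2n x ^ e) * evalMon es xs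

-- value of h at x, computed in ℕ (its image in F_p is this value mod p)
evalℕ : ∀ {p n} → Poly p n → Vec Bool n → ℕ
evalℕ List.[] x = 0
evalℕ (t List.∷ ts) x = toℕ (Term.coeff t) * evalMon (Term.expo t) x + evalℕ ts x

VanishesAt : ∀ {p n} → Poly p n → Vec Bool n → Set
VanishesAt {p} h x = p ∣ evalℕ h x

{-# OPTIONS --safe #-}
-- For a power Q of p, p divides Q C k whenever 0 < k < Q, so by Pascal's rule
-- m ↦ (m C d) mod p is Q-periodic for d < Q. The polynomial with value ((|x| + a) C d) mod p
-- at x has degree d. With q = p^ℓ: in (a), d = q − 1 and a = q − 1 − i make this value the
-- indicator of |x| ≡ i (mod q); in (b), d = j − i − q and a = P − i − q with P = p^j > j make
-- it (|x| − i − q) C d mod p whenever |x| ≥ i + q (forced by |x| > i, |x| ≡ i), which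
-- vanishes for |x| < j and is 1 at |x| = j.
module Submission where

open import Defs
open import Data.Nat
open import Data.Nat.Properties
open import Data.Nat.Divisibility
open import Data.Nat.DivMod
open import Data.Nat.Combinatorics using (_C_; nCn≡1; nC1≡n; k>n⇒nCk≡0; nCk+nC[k+1]≡[n+1]C[k+1])
open import Data.Nat.Primality using (Prime; euclidsLemma; prime⇒nonZero; prime⇒nonTrivial)
open import Data.Fin using (toℕ; fromℕ<)
open import Data.Fin.Properties using (toℕ-fromℕ<)
open import Data.Bool using (Bool; true; false)
open import Data.Vec using (Vec; []; _∷_; replicate)
open import Data.List using ([]; _∷_; _++_; map)
open import Data.List.Relation.Unary.All using ([]; _∷_)
open import Data.List.Relation.Unary.All.Properties using (++⁺; map⁺)
import Data.List.Relation.Unary.All as All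
open import Data.Product using (Σ; _×_; _,_)
open import Data.Sum using (inj₁; inj₂)
open import Data.Empty using (⊥-elim)
open import Function using (_∘_)
open import Function.Bundles using (_⇔_; mk⇔; Equivalence)
open import Function.Properties.Equivalence using () renaming (trans to ⇔-trans)
open import Relation.Binary.PropositionalEquality
open import Relation.Binary.Definitions using (tri<; tri≈; tri>)
open import Relation.Nullary using (¬_; yes; no)
open import Algebra.Properties.CommutativeSemigroup *-commutativeSemigroup using (x∙yz≈y∙xz)

module _ {q : ℕ} .{{_ : NonZero q}} where

  ∣∸⇒%≡ : ∀ {a b} → b ≤ a → q ∣ a ∸ b → a % q ≡ b % q
  ∣∸⇒%≡ {a} {b} b≤a q∣a∸b = begin
    a % q             ≡⟨ %-congˡ (m+[n∸m]≡n b≤a) ⟨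
    (b + (a ∸ b)) % q ≡⟨ %-remove-+ʳ b q∣a∸b ⟩
    b % q             ∎
    where open ≡-Reasoning

  ≡[mod]⇒%≡ : ∀ {a b} → a ≡ b [mod q ] → a % q ≡ b % q
  ≡[mod]⇒%≡ {a} {b} q∣∣a-b∣ with ≤-total b a
  ... | inj₁ b≤a = ∣∸⇒%≡ b≤a (subst (q ∣_) (m≤n⇒∣n-m∣≡n∸m b≤a) q∣∣a-b∣)
  ... | inj₂ a≤b = sym (∣∸⇒%≡ a≤b (subst (q ∣_) (m≤n⇒∣m-n∣≡n∸m a≤b) q∣∣a-b∣))

  %≡⇒≡[mod] : ∀ {a b} → a % q ≡ b % q → a ≡ b [mod q ]
  %≡⇒≡[mod] {a} {b} a%q≡b%q = subst (q ∣_) (sym ∣a-b∣≡∣a/q-b/q∣*q) (n∣m*n ∣ a / q - b / q ∣)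
    where
    open ≡-Reasoning
    ∣a-b∣≡∣a/q-b/q∣*q : ∣ a - b ∣ ≡ ∣ a / q - b / q ∣ * q
    ∣a-b∣≡∣a/q-b/q∣*q = begin
      ∣ a - b ∣
        ≡⟨ cong₂ ∣_-_∣ (m≡m%n+[m/n]*n a q) (m≡m%n+[m/n]*n b q) ⟩
      ∣ a % q + a / q * q - b % q + b / q * q ∣
        ≡⟨ cong (λ r → ∣ a % q + a / q * q - r + b / q * q ∣) a%q≡b%q ⟨
      ∣ a % q + a / q * q - a % q + b / q * q ∣
        ≡⟨ ∣m+n-m+o∣≡∣n-o∣ (a % q) (a / q * q) (b / q * q) ⟩
      ∣ a / q * q - b / q * q ∣
        ≡⟨ *-distribʳ-∣-∣ q (a / q) (b / q) ⟨
      ∣ a / q - b / q ∣ * q ∎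

  ≡[mod]⇔%≡ : ∀ w {i} → i < q → (w ≡ i [mod q ] ⇔ w % q ≡ i)
  ≡[mod]⇔%≡ w i<q = mk⇔ (λ w≡i → trans (≡[mod]⇒%≡ w≡i) (m<n⇒m%n≡m i<q))
                      (λ w%q≡i → %≡⇒≡[mod] (trans w%q≡i (sym (m<n⇒m%n≡m i<q))))

≡[mod]∧>⇒+≤ : ∀ {q i w} → i < w → w ≡ i [mod q ] → i + q ≤ w
≡[mod]∧>⇒+≤ {q} {i} {w} i<w q∣∣w-i∣ = begin
  i + q       ≤⟨ +-monoʳ-≤ i (∣⇒≤ {{>-nonZero (m<n⇒0<n∸m i<w)}} q∣w∸i) ⟩
  i + (w ∸ i) ≡⟨ m+[n∸m]≡n (<⇒≤ i<w) ⟩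
  w           ∎
  where
  open ≤-Reasoning
  q∣w∸i : q ∣ w ∸ i
  q∣w∸i = subst (q ∣_) (m≤n⇒∣n-m∣≡n∸m (<⇒≤ i<w)) q∣∣w-i∣

%-cong-+ : ∀ {a a′ b b′ d} .{{_ : NonZero d}} →
           a % d ≡ a′ % d → b % d ≡ b′ % d → (a + b) % d ≡ (a′ + b′) % d
%-cong-+ {a} {a′} {b} {b′} {d} a≡a′ b≡b′ = begin
  (a + b) % d             ≡⟨ %-distribˡ-+ a b d ⟩
  (a % d + b % d) % d     ≡⟨ cong₂ (λ x y → (x + y) % d) a≡a′ b≡b′ ⟩
  (a′ % d + b′ % d) % d   ≡⟨ %-distribˡ-+ a′ b′ d ⟨
  (a′ + b′) % d           ∎
  where open ≡-Reasoning

nonTrivial⇒∤1 : ∀ {p} .{{_ : NonTrivial p}} → ¬ p ∣ 1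
nonTrivial⇒∤1 = nonTrivial⇒≢1 ∘ ∣1⇒≡1

%≡⇒∣⇔∣ : ∀ {a b d} .{{_ : NonZero d}} → a % d ≡ b % d → (d ∣ a ⇔ d ∣ b)
%≡⇒∣⇔∣ {a} {b} {d} a%d≡b%d =
  mk⇔ (λ d∣a → m%n≡0⇒n∣m b d (trans (sym a%d≡b%d) (n∣m⇒m%n≡0 a d d∣a)))
      (λ d∣b → m%n≡0⇒n∣m a d (trans a%d≡b%d (n∣m⇒m%n≡0 b d d∣b)))

n<m^n : ∀ m → 1 < m → ∀ n → n < m ^ n
n<m^n m 1<m zero    = z<s
n<m^n m 1<m (suc n) = ≤-<-trans (n<m^n m 1<m n) (^-monoʳ-< m 1<m (n<1+n n))

[k+1]*[n+1]C[k+1]≡[n+1]*nCk : ∀ n k → suc k * (suc n C suc k) ≡ suc n * (n C k)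
[k+1]*[n+1]C[k+1]≡[n+1]*nCk zero    zero    = refl
[k+1]*[n+1]C[k+1]≡[n+1]*nCk zero    (suc k) = *-zeroʳ (2 + k)
[k+1]*[n+1]C[k+1]≡[n+1]*nCk (suc n) zero    =
  trans (+-identityʳ _) (trans (nC1≡n (2 + n)) (sym (*-identityʳ (2 + n))))
[k+1]*[n+1]C[k+1]≡[n+1]*nCk (suc n) (suc k) = begin
  (2 + k) * (suc m C (2 + k))
    ≡⟨ cong ((2 + k) *_) (nCk+nC[k+1]≡[n+1]C[k+1] m (suc k)) ⟨
  (2 + k) * (X + m C (2 + k))
    ≡⟨ *-distribˡ-+ (2 + k) X (m C (2 + k)) ⟩
  (X + suc k * X) + (2 + k) * (m C (2 + k))
    ≡⟨ cong₂ (λ y z → (X + y) + z) ([k+1]*[n+1]C[k+1]≡[n+1]*nCk n k)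
                                   ([k+1]*[n+1]C[k+1]≡[n+1]*nCk n (suc k)) ⟩
  (X + m * (n C k)) + m * (n C suc k)
    ≡⟨ +-assoc X (m * (n C k)) (m * (n C suc k)) ⟩
  X + (m * (n C k) + m * (n C suc k))
    ≡⟨ cong (X +_) (*-distribˡ-+ m (n C k) (n C suc k)) ⟨
  X + m * (n C k + n C suc k)
    ≡⟨ cong (λ y → X + m * y) (nCk+nC[k+1]≡[n+1]C[k+1] n k) ⟩
  X + m * X ∎
  where
  open ≡-Reasoning
  m = suc n
  X = m C suc k

p^e∣m*n∧p∤n⇒p^e∣m : ∀ {p} → Prime p → ∀ e {m n} → p ^ e ∣ m * n → ¬ p ∣ n → p ^ e ∣ m
p^e∣m*n∧p∤n⇒p^e∣m     pp zero    {m}     _     _   = 1∣ m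
p^e∣m*n∧p∤n⇒p^e∣m {p} pp (suc e) {m} {n} p^e∣mn p∤n
  with euclidsLemma m n pp (∣-trans (m∣m*n (p ^ e)) p^e∣mn)
... | inj₂ p∣n = ⊥-elim (p∤n p∣n)
... | inj₁ (divides m′ refl) = subst (p * p ^ e ∣_) (*-comm p m′) (*-monoʳ-∣ p p^e∣m′)
  where
  instance _ = prime⇒nonZero pp
  p^e∣m′ : p ^ e ∣ m′
  p^e∣m′ = p^e∣m*n∧p∤n⇒p^e∣m pp e
             (*-cancelˡ-∣ p (subst (p * p ^ e ∣_) (rearrange m′) p^e∣mn)) p∤n
    where
    rearrange : ∀ x → x * p * n ≡ p * (x * n)
    rearrange x = trans (cong (_* n) (*-comm x p)) (*-assoc p x n)

InnerBinomialsDivisible : ℕ → ℕ → Set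
InnerBinomialsDivisible p q = ∀ k → 0 < k → k < q → p ∣ q C k

-- By absorption, p ∤ q C (k + 1) would force q ∣ k + 1.
innerBinomialsDivisible-p^e : ∀ {p} → Prime p → ∀ e → InnerBinomialsDivisible p (p ^ e)
innerBinomialsDivisible-p^e {p} pp e (suc k) _ k<p^e with p ^ e in p^e≡q
... | zero = ⊥-elim (n≮0 k<p^e)
... | suc n with p ∣? (suc n C suc k)
...   | yes p∣c = p∣c
...   | no  p∤c = ⊥-elim (<⇒≱ k<p^e (∣⇒≤ q∣suc-k))
  where
  q∣suc-k : suc n ∣ suc k
  q∣suc-k = subst (_∣ suc k) p^e≡q (p^e∣m*n∧p∤n⇒p^e∣m pp e
              (subst (_∣ suc k * (suc n C suc k)) (sym p^e≡q)
                (subst (suc n ∣_) (sym ([k+1]*[n+1]C[k+1]≡[n+1]*nCk n k)) (m∣m*n (n C k))))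
              p∤c)

module _ {p q : ℕ} .{{_ : NonZero p}} (inner : InnerBinomialsDivisible p q) where

  [q+m]Cd≡mCd : ∀ m d → d < q → ((q + m) C d) % p ≡ (m C d) % p
  [q+m]Cd≡mCd m       zero    _   = refl
  [q+m]Cd≡mCd zero    (suc d) d<q = begin
    ((q + 0) C suc d) % p ≡⟨ cong (λ n → (n C suc d) % p) (+-identityʳ q) ⟩
    (q C suc d) % p       ≡⟨ n∣m⇒m%n≡0 (q C suc d) p (inner (suc d) z<s d<q) ⟩
    0                     ≡⟨ n∣m⇒m%n≡0 0 p (p ∣0) ⟨
    0 % p                 ∎
    where open ≡-Reasoning
  [q+m]Cd≡mCd (suc m) (suc d) d<q = begin
    ((q + suc m) C suc d) % p
      ≡⟨ cong (λ n → (n C suc d) % p) (+-suc q m) ⟩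
    (suc (q + m) C suc d) % p
      ≡⟨ cong (_% p) (nCk+nC[k+1]≡[n+1]C[k+1] (q + m) d) ⟨
    ((q + m) C d + (q + m) C suc d) % p
      ≡⟨ %-cong-+ ([q+m]Cd≡mCd m d (<-trans (n<1+n d) d<q)) ([q+m]Cd≡mCd m (suc d) d<q) ⟩
    (m C d + m C suc d) % p
      ≡⟨ cong (_% p) (nCk+nC[k+1]≡[n+1]C[k+1] m d) ⟩
    (suc m C suc d) % p ∎
    where open ≡-Reasoning

  [s*q+m]Cd≡mCd : ∀ s m d → d < q → ((s * q + m) C d) % p ≡ (m C d) % p
  [s*q+m]Cd≡mCd zero    m d _   = refl
  [s*q+m]Cd≡mCd (suc s) m d d<q = begin
    ((q + s * q + m) C d) % p   ≡⟨ cong (λ n → (n C d) % p) (+-assoc q (s * q) m) ⟩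
    ((q + (s * q + m)) C d) % p ≡⟨ [q+m]Cd≡mCd (s * q + m) d d<q ⟩
    ((s * q + m) C d) % p       ≡⟨ [s*q+m]Cd≡mCd s m d d<q ⟩
    (m C d) % p                 ∎
    where open ≡-Reasoning

module _ (p : ℕ) .{{_ : NonZero p}} where

  constPoly : ∀ {n} → ℕ → Poly p n
  constPoly {n} c = term (fromℕ< (m%n<n c p)) (replicate n 0) ∷ []

  lift : ∀ {n} → Poly p n → Poly p (suc n)
  lift = map (λ t → term (Term.coeff t) (0 ∷ Term.expo t))

  X₀*lift : ∀ {n} → Poly p n → Poly p (suc n)
  X₀*lift = map (λ t → term (Term.coeff t) (1 ∷ Term.expo t))

  -- Pascal's rule in the first variable:
  -- (w + x₀ + a) C (d + 1) = (w + a) C (d + 1) + x₀ · (w + a) C d  for x₀ ∈ {0, 1}.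
  binomialPoly : ∀ {n} → ℕ → ℕ → Poly p n
  binomialPoly {zero}  a d       = constPoly (a C d)
  binomialPoly {suc n} a zero    = constPoly 1
  binomialPoly {suc n} a (suc d) = lift (binomialPoly a (suc d)) ++ X₀*lift (binomialPoly a d)

  evalMon-replicate0 : ∀ {n} (x : Vec Bool n) → evalMon (replicate n 0) x ≡ 1
  evalMon-replicate0 []      = refl
  evalMon-replicate0 (_ ∷ x) = cong (1 *_) (evalMon-replicate0 x)

  totalDeg-replicate0 : ∀ n → totalDeg (replicate n 0) ≡ 0
  totalDeg-replicate0 zero    = refl
  totalDeg-replicate0 (suc n) = totalDeg-replicate0 n

  evalℕ-constPoly : ∀ {n} c (x : Vec Bool n) → evalℕ (constPoly c) x ≡ c % p
  evalℕ-constPoly c x = begin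
    toℕ (fromℕ< (m%n<n c p)) * evalMon (replicate _ 0) x + 0
      ≡⟨ +-identityʳ _ ⟩
    toℕ (fromℕ< (m%n<n c p)) * evalMon (replicate _ 0) x
      ≡⟨ cong₂ _*_ (toℕ-fromℕ< (m%n<n c p)) (evalMon-replicate0 x) ⟩
    c % p * 1
      ≡⟨ *-identityʳ (c % p) ⟩
    c % p ∎
    where open ≡-Reasoning

  evalℕ-++ : ∀ {n} (P R : Poly p n) x → evalℕ (P ++ R) x ≡ evalℕ P x + evalℕ R x
  evalℕ-++ []      R x = refl
  evalℕ-++ (t ∷ P) R x =
    trans (cong (_ +_) (evalℕ-++ P R x)) (sym (+-assoc _ (evalℕ P x) (evalℕ R x)))

  evalℕ-lift : ∀ {n} (P : Poly p n) b x → evalℕ (lift P) (b ∷ x) ≡ evalℕ P x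
  evalℕ-lift []      b x = refl
  evalℕ-lift (t ∷ P) b x =
    cong₂ _+_ (cong (toℕ (Term.coeff t) *_) (+-identityʳ _)) (evalℕ-lift P b x)

  evalℕ-X₀*lift : ∀ {n} (P : Poly p n) b x → evalℕ (X₀*lift P) (b ∷ x) ≡ b2n b * evalℕ P x
  evalℕ-X₀*lift []      b x = sym (*-zeroʳ (b2n b))
  evalℕ-X₀*lift (t ∷ P) b x = begin
    c * (b2n b ^ 1 * e) + evalℕ (X₀*lift P) (b ∷ x)
      ≡⟨ cong₂ (λ y z → c * (y * e) + z) (*-identityʳ (b2n b)) (evalℕ-X₀*lift P b x) ⟩
    c * (b2n b * e) + b2n b * evalℕ P x
      ≡⟨ cong (_+ b2n b * evalℕ P x) (x∙yz≈y∙xz c (b2n b) e) ⟩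
    b2n b * (c * e) + b2n b * evalℕ P x
      ≡⟨ *-distribˡ-+ (b2n b) (c * e) (evalℕ P x) ⟨
    b2n b * (c * e + evalℕ P x) ∎
    where
    open ≡-Reasoning
    c = toℕ (Term.coeff t)
    e = evalMon (Term.expo t) x

  evalℕ-lift++X₀*lift : ∀ {n} (P R : Poly p n) b x →
                        evalℕ (lift P ++ X₀*lift R) (b ∷ x) ≡ evalℕ P x + b2n b * evalℕ R x
  evalℕ-lift++X₀*lift P R b x =
    trans (evalℕ-++ (lift P) (X₀*lift R) (b ∷ x)) (cong₂ _+_ (evalℕ-lift P b x) (evalℕ-X₀*lift R b x))

  evalℕ-binomialPoly : ∀ {n} a d (x : Vec Bool n) →
                       evalℕ (binomialPoly a d) x % p ≡ ((weight x + a) C d) % p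
  evalℕ-binomialPoly {zero}  a d       [] =
    trans (cong (_% p) (evalℕ-constPoly (a C d) [])) (m%n%n≡m%n (a C d) p)
  evalℕ-binomialPoly {suc n} a zero    x  =
    trans (cong (_% p) (evalℕ-constPoly 1 x)) (m%n%n≡m%n 1 p)
  evalℕ-binomialPoly {suc n} a (suc d) (b ∷ x) =
    trans (cong (_% p) (evalℕ-lift++X₀*lift Q₁ Q₀ b x)) (pascal b)
    where
    open ≡-Reasoning
    Q₀ = binomialPoly a d
    Q₁ = binomialPoly a (suc d)
    w+a = weight x + a
    pascal : ∀ b → (evalℕ Q₁ x + b2n b * evalℕ Q₀ x) % p ≡ ((weight (b ∷ x) + a) C suc d) % p
    pascal false = trans (cong (_% p) (+-identityʳ _)) (evalℕ-binomialPoly a (suc d) x)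
    pascal true  = begin
      (evalℕ Q₁ x + (evalℕ Q₀ x + 0)) % p
        ≡⟨ %-cong-+ (evalℕ-binomialPoly a (suc d) x)
                    (trans (cong (_% p) (+-identityʳ _)) (evalℕ-binomialPoly a d x)) ⟩
      (w+a C suc d + w+a C d) % p         ≡⟨ cong (_% p) (+-comm (w+a C suc d) (w+a C d)) ⟩
      (w+a C d + w+a C suc d) % p         ≡⟨ cong (_% p) (nCk+nC[k+1]≡[n+1]C[k+1] w+a d) ⟩
      (suc w+a C suc d) % p               ∎

  DegLe-constPoly : ∀ {n} c d → DegLe (constPoly {n} c) d
  DegLe-constPoly {n} c d = (λ _ → subst (_≤ d) (sym (totalDeg-replicate0 n)) z≤n) ∷ []

  DegLe-lift : ∀ {n} {P : Poly p n} {d} → DegLe P d → DegLe (lift P) d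
  DegLe-lift = map⁺

  DegLe-X₀*lift : ∀ {n} {P : Poly p n} {d} → DegLe P d → DegLe (X₀*lift P) (suc d)
  DegLe-X₀*lift = map⁺ ∘ All.map (s≤s ∘_)

  DegLe-binomialPoly : ∀ {n} a d → DegLe (binomialPoly {n} a d) d
  DegLe-binomialPoly {zero}  a d       = DegLe-constPoly (a C d) d
  DegLe-binomialPoly {suc n} a zero    = DegLe-constPoly 1 0
  DegLe-binomialPoly {suc n} a (suc d) =
    ++⁺ (DegLe-lift (DegLe-binomialPoly a (suc d))) (DegLe-X₀*lift (DegLe-binomialPoly a d))

module _ {p d : ℕ} .{{_ : NonZero p}} (inner : InnerBinomialsDivisible p (suc d)) where

  [w+a]Cd≡[w%[1+d]+a]Cd : ∀ w a → ((w + a) C d) % p ≡ ((w % suc d + a) C d) % p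
  [w+a]Cd≡[w%[1+d]+a]Cd w a = begin
    ((w + a) C d) % p                       ≡⟨ cong (λ n → (n C d) % p) w+a≡[w/q]*q+[w%q+a] ⟩
    ((w / q * q + (w % q + a)) C d) % p     ≡⟨ [s*q+m]Cd≡mCd inner (w / q) (w % q + a) d ≤-refl ⟩
    ((w % q + a) C d) % p                   ∎
    where
    open ≡-Reasoning
    q = suc d
    w+a≡[w/q]*q+[w%q+a] : w + a ≡ w / q * q + (w % q + a)
    w+a≡[w/q]*q+[w%q+a] = begin
      w + a                   ≡⟨ cong (_+ a) (m≡m%n+[m/n]*n w q) ⟩
      w % q + w / q * q + a   ≡⟨ cong (_+ a) (+-comm (w % q) (w / q * q)) ⟩
      w / q * q + w % q + a   ≡⟨ +-assoc (w / q * q) (w % q) a ⟩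
      w / q * q + (w % q + a) ∎

  p∣[u+d∸i]Cd : ∀ {i u} → i ≤ d → u ≤ d → u ≢ i → p ∣ (u + (d ∸ i)) C d
  p∣[u+d∸i]Cd {i} {u} i≤d u≤d u≢i with <-cmp u i
  ... | tri< u<i _ _ = subst (p ∣_) (sym (k>n⇒nCk≡0 u+d∸i<d)) (p ∣0)
    where
    u+d∸i<d : u + (d ∸ i) < d
    u+d∸i<d = subst (u + (d ∸ i) <_) (m+[n∸m]≡n i≤d) (+-monoˡ-< (d ∸ i) u<i)
  ... | tri≈ _ u≡i _ = ⊥-elim (u≢i u≡i)
  ... | tri> _ _ i<u =
    Equivalence.from (%≡⇒∣⇔∣ shifted) (subst (p ∣_) (sym (k>n⇒nCk≡0 r<d)) (p ∣0))
    where
    open ≡-Reasoning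
    r = u ∸ suc i
    u+d∸i≡1+d+r : u + (d ∸ i) ≡ suc d + r
    u+d∸i≡1+d+r = begin
      u + (d ∸ i)           ≡⟨ cong (_+ (d ∸ i)) (m∸n+n≡m i<u) ⟨
      r + suc i + (d ∸ i)   ≡⟨ +-assoc r (suc i) (d ∸ i) ⟩
      r + suc (i + (d ∸ i)) ≡⟨ cong (λ n → r + suc n) (m+[n∸m]≡n i≤d) ⟩
      r + suc d             ≡⟨ +-comm r (suc d) ⟩
      suc d + r             ∎
    shifted : ((u + (d ∸ i)) C d) % p ≡ (r C d) % p
    shifted = trans (cong (λ n → (n C d) % p) u+d∸i≡1+d+r) ([q+m]Cd≡mCd inner r d ≤-refl)
    r<d : r < d
    r<d = <-≤-trans (m<m+n r z<s) (subst (_≤ d) (sym (m∸n+n≡m i<u)) u≤d)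

  p∣[w+d∸i]Cd⇔w≢i : .{{_ : NonTrivial p}} → ∀ {i} → i ≤ d → ∀ w →
                    (p ∣ (w + (d ∸ i)) C d ⇔ (¬ w ≡ i [mod suc d ]))
  p∣[w+d∸i]Cd⇔w≢i {i} i≤d w with w % suc d ≟ i
  ... | yes u≡i =
    mk⇔ (λ p∣v _ → nonTrivial⇒∤1 (subst (p ∣_) [u+d∸i]Cd≡1 (Equivalence.to reduced p∣v)))
        (λ w≢i → ⊥-elim (w≢i (Equivalence.from (≡[mod]⇔%≡ w (s≤s i≤d)) u≡i)))
    where
    [u+d∸i]Cd≡1 : (w % suc d + (d ∸ i)) C d ≡ 1
    [u+d∸i]Cd≡1 = trans (cong (λ u → (u + (d ∸ i)) C d) u≡i)
                        (trans (cong (_C d) (m+[n∸m]≡n i≤d)) (nCn≡1 d))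
    reduced : p ∣ (w + (d ∸ i)) C d ⇔ p ∣ (w % suc d + (d ∸ i)) C d
    reduced = %≡⇒∣⇔∣ ([w+a]Cd≡[w%[1+d]+a]Cd w (d ∸ i))
  ... | no  u≢i =
    mk⇔ (λ _ w≡i → u≢i (Equivalence.to (≡[mod]⇔%≡ w (s≤s i≤d)) w≡i))
        (λ _ → Equivalence.from (%≡⇒∣⇔∣ ([w+a]Cd≡[w%[1+d]+a]Cd w (d ∸ i)))
                 (p∣[u+d∸i]Cd i≤d (≤-pred (m%n<n w (suc d))) u≢i))

module _ {p P : ℕ} .{{_ : NonZero p}} (inner : InnerBinomialsDivisible p P) where

  p∣[w+P∸c]C[j∸c]⇔p∣[w∸c]C[j∸c] : ∀ {c w j} → c ≤ w → c ≤ j → j < P →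
    (p ∣ (w + (P ∸ c)) C (j ∸ c) ⇔ p ∣ (w ∸ c) C (j ∸ c))
  p∣[w+P∸c]C[j∸c]⇔p∣[w∸c]C[j∸c] {c} {w} {j} c≤w c≤j j<P = %≡⇒∣⇔∣ (begin
    ((w + (P ∸ c)) C (j ∸ c)) % p ≡⟨ cong (λ n → (n C (j ∸ c)) % p) w+[P∸c]≡P+[w∸c] ⟩
    ((P + (w ∸ c)) C (j ∸ c)) % p ≡⟨ [q+m]Cd≡mCd inner (w ∸ c) (j ∸ c) (≤-<-trans (m∸n≤m j c) j<P) ⟩
    ((w ∸ c) C (j ∸ c)) % p       ∎)
    where
    open ≡-Reasoning
    w+[P∸c]≡P+[w∸c] : w + (P ∸ c) ≡ P + (w ∸ c)
    w+[P∸c]≡P+[w∸c] = begin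
      w + (P ∸ c) ≡⟨ +-∸-assoc w (≤-trans c≤j (<⇒≤ j<P)) ⟨
      w + P ∸ c   ≡⟨ cong (_∸ c) (+-comm w P) ⟩
      P + w ∸ c   ≡⟨ +-∸-assoc P c≤w ⟩
      P + (w ∸ c) ∎

  p∣[w+P∸c]C[j∸c] : ∀ {c w j} → c ≤ w → w < j → j < P → p ∣ (w + (P ∸ c)) C (j ∸ c)
  p∣[w+P∸c]C[j∸c] {c} {w} {j} c≤w w<j j<P =
    Equivalence.from (p∣[w+P∸c]C[j∸c]⇔p∣[w∸c]C[j∸c] c≤w (≤-trans c≤w (<⇒≤ w<j)) j<P)
      (subst (p ∣_) (sym (k>n⇒nCk≡0 (∸-monoˡ-< w<j c≤w))) (p ∣0))

  p∤[j+P∸c]C[j∸c] : .{{_ : NonTrivial p}} → ∀ {c j} → c ≤ j → j < P →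
                    ¬ p ∣ (j + (P ∸ c)) C (j ∸ c)
  p∤[j+P∸c]C[j∸c] {c} {j} c≤j j<P =
    nonTrivial⇒∤1 ∘ subst (p ∣_) (nCn≡1 (j ∸ c))
      ∘ Equivalence.to (p∣[w+P∸c]C[j∸c]⇔p∣[w∸c]C[j∸c] c≤j c≤j j<P)

module _ {p : ℕ} .{{_ : NonZero p}} .{{_ : NonTrivial p}} {n : ℕ} where

  congruenceIndicator : ∀ {q i} → InnerBinomialsDivisible p q → i < q →
    Σ (Poly p n) λ h → DegLe h (q ∸ 1)
      × ((x : Vec Bool n) → (VanishesAt h x ⇔ (¬ (weight x ≡ i [mod q ]))))
  congruenceIndicator {suc d} {i} inner (s≤s i≤d) =
    binomialPoly p (d ∸ i) d , DegLe-binomialPoly p (d ∸ i) d ,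
    λ x → ⇔-trans (%≡⇒∣⇔∣ (evalℕ-binomialPoly p (d ∸ i) d x))
                  (p∣[w+d∸i]Cd⇔w≢i inner i≤d (weight x))

  intervalSeparator : ∀ {P q i j} → InnerBinomialsDivisible p P → j < P →
    j ≡ i [mod q ] → i < j →
    Σ (Poly p n) λ r → DegLe r (j ∸ i ∸ q)
      × ((x : Vec Bool n) →
          ((i < weight x → weight x < j → weight x ≡ i [mod q ] → VanishesAt r x)
           × (weight x ≡ j → ¬ VanishesAt r x)))
  intervalSeparator {P} {q} {i} {j} inner j<P j≡i i<j =
    r , DegLe-binomialPoly p (P ∸ (i + q)) (j ∸ i ∸ q) ,
    λ x → (λ i<w w<j w≡i →
             Equivalence.from (value x) (p∣[w+P∸c]C[j∸c] inner (≡[mod]∧>⇒+≤ i<w w≡i) w<j j<P))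
        , (λ { refl → p∤[j+P∸c]C[j∸c] inner (≡[mod]∧>⇒+≤ i<j j≡i) j<P ∘ Equivalence.to (value x) })
    where
    r = binomialPoly p (P ∸ (i + q)) (j ∸ i ∸ q)
    value : ∀ x → VanishesAt r x ⇔ p ∣ (weight x + (P ∸ (i + q))) C (j ∸ (i + q))
    value x = %≡⇒∣⇔∣ (trans (evalℕ-binomialPoly p (P ∸ (i + q)) (j ∸ i ∸ q) x)
                            (cong (λ D → ((weight x + (P ∸ (i + q))) C D) % p) (∸-+-assoc j i q)))

lemma3p2 : (p : ℕ) → Prime p → (n i : ℕ) → i ≤ n → (ℓ : ℕ) → IsCeilLog p (suc i) ℓ →
    (Σ (Poly p n) λ h → DegLe h (p ^ ℓ ∸ 1)
        × ((x : Vec Bool n) → (VanishesAt h x ⇔ (¬ (weight x ≡ i [mod p ^ ℓ ])))))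
    × ((j : ℕ) → j ≤ n → j ≡ i [mod p ^ ℓ ] → i < j →
        Σ (Poly p n) λ r → DegLe r (j ∸ i ∸ p ^ ℓ)
          × ((x : Vec Bool n) →
              ((i < weight x → weight x < j → weight x ≡ i [mod p ^ ℓ ] → VanishesAt r x)
               × (weight x ≡ j → ¬ VanishesAt r x))))
lemma3p2 p pp n i _ ℓ (i<p^ℓ , _) =
  congruenceIndicator (inner ℓ) i<p^ℓ ,
  λ j _ j≡i i<j → intervalSeparator (inner j) (n<m^n p (nonTrivial⇒n>1 p) j) j≡i i<j
  where
  instance
    _ = prime⇒nonZero pp
    _ = prime⇒nonTrivial pp
  inner : ∀ e → InnerBinomialsDivisible p (p ^ e)
  inner = innerBinomialsDivisible-p^e pp
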